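{- There exist $\varepsilon>\delta>0$ and a family of $1$-dimensional Hegselmann–Krause systems, one with $n$ agents for each $n\ge 2$ and confidence bound $\varepsilon$, such that under uniform random asynchronous updates the expected number of steps until a $\delta$-stable state is reached is $\Omega(n^2)$.
   Context: A $1$-dimensional HKS consists of a finite simple undirected graph $G=(V,E)$ (social network), a confidence bound $\varepsilon>0$, and initial opinions $x_v(0)\in\mathbb{R}$. In a state $(x_v)$, $N(v)=\{u:\{u,v\}\in E,\ |x_u-x_v|\le\varepsilon\}\cup\{v\}$, the influence network is $(V,E_I)$ with $E_I=\{\{u,v\}\in E:|x_u-x_v|\le\varepsilon\}$, and the length of an edge $\{u,v\}$ is $|x_u-x_v|$. Uniform random asynchronous updates: at each step an agent $v$ is chosen uniformly at random (independently) and $x_v$ is replaced by $\frac{1}{|N(v)|}\sum_{u\in N(v)}x_u$; other agents keep their positions. A state is $\delta$-stable if every edge of its influence network has length at most $\delta$. -}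

module Defs where

open import Data.Bool using (Bool; true; false; _∧_; not; if_then_else_)
open import Data.Nat as ℕ using (ℕ; zero; suc)
open import Data.Fin using (Fin; _≟_)
open import Data.Bool using (T?; _∨_)
open import Data.List using (List; []; _∷_; filter; length; map; foldr; concatMap)
open import Data.List.Base using (allFin)
open import Data.Vec using (Vec; []; _∷_)
open import Data.Integer using (+_)
open import Data.Rational using (ℚ; _+_; _*_; _-_; ∣_∣; _≤ᵇ_; _/_; 0ℚ)
open import Relation.Nullary.Decidable using (⌊_⌋)
open import Relation.Binary.PropositionalEquality using (_≡_)

record Graph (n : ℕ) : Set where
  field
    adj    : Fin n → Fin n → Bool
    sym    : ∀ u v → adj u v ≡ adj v u
    irrefl : ∀ v → adj v v ≡ false
open Graph public

record HKS (n : ℕ) : Set where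
  field
    graph : Graph n
    x₀    : Fin n → ℚ
open HKS public

State : ℕ → Set
State n = Fin n → ℚ

-- 1/k as a rational (with 1/0 := 0, never used on relevant inputs)
inv : ℕ → ℚ
inv zero    = 0ℚ
inv (suc k) = + 1 / suc k

len : ∀ {n} → State n → Fin n → Fin n → ℚ
len x u v = ∣ x u - x v ∣

influenceEdge : ∀ {n} → Graph n → ℚ → State n → Fin n → Fin n → Bool
influenceEdge G ε x u v = adj G u v ∧ (len x u v ≤ᵇ ε)

sumℚ : List ℚ → ℚ
sumℚ = foldr _+_ 0ℚ

-- N(v) = {u : {u,v} ∈ E, |x_u - x_v| ≤ ε} ∪ {v}; since G is simple,
-- v is not among its own graph neighbours, so |N(v)| = 1 + #others.
others : ∀ {n} → Graph n → ℚ → State n → Fin n → List (Fin n)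
others {n} G ε x v = filter (λ u → T? (influenceEdge G ε x v u)) (allFin n)

newOpinion : ∀ {n} → Graph n → ℚ → State n → Fin n → ℚ
newOpinion G ε x v =
  (x v + sumℚ (map x (others G ε x v))) * inv (suc (length (others G ε x v)))

step : ∀ {n} → Graph n → ℚ → State n → Fin n → State n
step G ε x v w = if ⌊ w ≟ v ⌋ then newOpinion G ε x v else x w

allB : ∀ {A : Set} → (A → Bool) → List A → Bool
allB p = foldr (λ a b → p a ∧ b) true

isStable : ∀ {n} → Graph n → ℚ → ℚ → State n → Bool
isStable {n} G ε δ x =
  allB (λ u → allB (λ v → not (influenceEdge G ε x u v) ∨ (len x u v ≤ᵇ δ)) (allFin n)) (allFin n)

seqs : (n t : ℕ) → List (Vec (Fin n) t)
seqs n zero    = [] ∷ []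
seqs n (suc t) = concatMap (λ v → map (v ∷_) (seqs n t)) (allFin n)

-- along the choice sequence (first element = first update), none of the
-- states x(0), x(1), ..., x(t) is δ-stable, i.e. the hitting time T > t
neverStable : ∀ {n t} → Graph n → ℚ → ℚ → State n → Vec (Fin n) t → Bool
neverStable G ε δ x []       = not (isStable G ε δ x)
neverStable G ε δ x (v ∷ vs) = not (isStable G ε δ x) ∧ neverStable G ε δ (step G ε x v) vs

-- P(T > t) under uniform random asynchronous updates:
-- (number of choice sequences of length t with T > t) / n^t
tailProb : ∀ {n} → HKS n → ℚ → ℚ → ℕ → ℚ
tailProb {n} S ε δ t =
  (+ length (filter (λ s → T? (neverStable (graph S) ε δ (x₀ S) s)) (seqs n t)))
    / 1 * inv (n ℕ.^ t)

-- partial sums of E[T] = Σ_{t ≥ 0} P(T > t):  Σ_{t < K} P(T > t)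
partialExp : ∀ {n} → HKS n → ℚ → ℚ → ℕ → ℚ
partialExp S ε δ zero    = 0ℚ
partialExp S ε δ (suc K) = partialExp S ε δ K + tailProb S ε δ K

{-# OPTIONS --safe #-}
module Submission where

-- The agents form two cliques, the even and the odd ones, joined by the single bridge {0, 1};
-- even agents start at opinion 1, odd ones at 0, and ε = 1, δ = 1/2. Every update inside a
-- clique averages opinions of one side only, so the invariant that even opinions lie within d
-- of 1 and odd ones within d of 0 is preserved. An endpoint of the bridge averages at least
-- M = 2 + ⌊(n-2)/2⌋ opinions of which a single one lies across the bridge, so updating it costs
-- at most 1/M of slack. Hence the bridge remains longer than 1/2 while its endpoints have been
-- chosen fewer than M/4 times. Among the n^t choice sequences of length t the endpoints are
-- chosen 2t/n times on average, so by Markov's inequality P(T > t) ≥ 1/2 for t up to about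
-- n²/32, and already the partial sums of E[T] = Σ_t P(T > t) exceed n²/256.

module SlowStabilisation where

  open import Data.Bool using (Bool; true; false; T; not; _∧_; _∨_; if_then_else_)
  open import Data.Bool.Properties using (¬-not; T-∧; T-≡; not-involutive)
  open import Data.Fin using (Fin; zero; suc; toℕ; _≟_)
  open import Data.Integer as ℤ using (+_; +≤+)
  import Data.Integer.Properties as ℤ
  open import Data.List using (List; []; _∷_; length; map; filter; allFin; tabulate; concatMap)
  open import Data.List.Properties using (filter-≐; length-++; length-map; length-tabulate; map-++; map-∘; map-cong; map-tabulate)
  open import Data.List.Membership.Propositional using (_∈_)
  open import Data.List.Membership.Propositional.Properties using (∈-allFin)
  open import Data.List.Relation.Unary.All as All using (All; []; _∷_)
  import Data.List.Relation.Unary.All.Properties as All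
  open import Data.List.Relation.Unary.Any using (here; there)
  open import Data.Nat as ℕ using (ℕ; zero; suc; z≤n; s≤s; ⌊_/2⌋)
  import Data.Nat.Properties as ℕ
  open import Data.Nat.Coprimality as Coprime using (1-coprimeTo)
  open import Data.Nat.DivMod using (m≥n⇒m/n>0; m/n*n≤m; m≡m%n+[m/n]*n; m%n<n)
  open import Data.Nat.ListAction using (sum)
  open import Data.Nat.ListAction.Properties using (sum-++)
  open import Data.Nat.Tactic.RingSolver using (solve-∀)
  open import Data.Product using (Σ; _×_; _,_; proj₁; proj₂)
  open import Data.Rational using (ℚ; mkℚ; 0ℚ; 1ℚ; ½; _+_; _*_; _-_; -_; _/_; ∣_∣; _≤_; _<_; *≤*; *<*; positive; nonNegative)
  open import Data.Rational.Properties hiding (_≟_)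
  open import Data.Rational.Solver using (module +-*-Solver)
  open import Data.Sum using (inj₁; inj₂)
  open import Data.Unit using (tt)
  open import Data.Vec as Vec using (Vec; []; _∷_)
  open import Function using (Equivalence)
  open import Relation.Nullary using (Dec; yes; no; ¬?; contradiction)
  open import Relation.Nullary.Decidable using (T?)
  open import Relation.Binary.PropositionalEquality
  open import Algebra.Properties.CommutativeSemigroup ℕ.+-commutativeSemigroup using () renaming (interchange to +-interchange)
  open import Algebra.Properties.CommutativeSemigroup ℕ.*-commutativeSemigroup using () renaming (x∙yz≈y∙xz to *-left-comm)
  open import Defs hiding (sym)

  open +-*-Solver

  n≤1+⌊n/2⌋+⌊n/2⌋ : ∀ n → n ℕ.≤ suc (⌊ n /2⌋ ℕ.+ ⌊ n /2⌋)
  n≤1+⌊n/2⌋+⌊n/2⌋ zero          = z≤n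
  n≤1+⌊n/2⌋+⌊n/2⌋ (suc zero)    = s≤s z≤n
  n≤1+⌊n/2⌋+⌊n/2⌋ (suc (suc n)) =
    s≤s (subst (suc n ℕ.≤_) (cong suc (sym (ℕ.+-suc ⌊ n /2⌋ ⌊ n /2⌋))) (s≤s (n≤1+⌊n/2⌋+⌊n/2⌋ n)))

  8q≤n≤16q : ∀ n → 8 ℕ.≤ n → Σ ℕ λ r → 8 ℕ.* suc r ℕ.≤ n × n ℕ.≤ 16 ℕ.* suc r
  8q≤n≤16q n 8≤n with n ℕ./ 8 in eq | m≥n⇒m/n>0 {n} {8} 8≤n
  ... | suc r | _ = r , lower , upper
    where
    open ℕ.≤-Reasoning
    lower : 8 ℕ.* suc r ℕ.≤ n
    lower = begin
      8 ℕ.* suc r     ≡⟨ ℕ.*-comm 8 (suc r) ⟩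
      suc r ℕ.* 8     ≡⟨ cong (ℕ._* 8) eq ⟨
      n ℕ./ 8 ℕ.* 8   ≤⟨ m/n*n≤m n 8 ⟩
      n               ∎
    upper : n ℕ.≤ 16 ℕ.* suc r
    upper = begin
      n                             ≡⟨ m≡m%n+[m/n]*n n 8 ⟩
      n ℕ.% 8 ℕ.+ n ℕ./ 8 ℕ.* 8     ≤⟨ ℕ.+-mono-≤ (ℕ.<⇒≤ (m%n<n n 8)) (ℕ.≤-reflexive (cong (ℕ._* 8) eq)) ⟩
      8 ℕ.+ suc r ℕ.* 8             ≤⟨ ℕ.+-monoˡ-≤ (suc r ℕ.* 8) (ℕ.*-monoʳ-≤ 8 (s≤s (z≤n {r}))) ⟩
      8 ℕ.* suc r ℕ.+ suc r ℕ.* 8   ≡⟨ 8q+q8≡16q (suc r) ⟩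
      16 ℕ.* suc r                  ∎
      where
      8q+q8≡16q : ∀ q → 8 ℕ.* q ℕ.+ q ℕ.* 8 ≡ 16 ℕ.* q
      8q+q8≡16q = solve-∀

  4t≤nq : ∀ {n q t} → 8 ℕ.* q ℕ.≤ n → t ℕ.< 2 ℕ.* (q ℕ.* q) → 4 ℕ.* t ℕ.≤ n ℕ.* q
  4t≤nq {n} {q} {t} 8q≤n t<2q² = begin
    4 ℕ.* t                   ≤⟨ ℕ.*-monoʳ-≤ 4 (ℕ.<⇒≤ t<2q²) ⟩
    4 ℕ.* (2 ℕ.* (q ℕ.* q))   ≡⟨ 4[2qq]≡8qq q ⟩
    8 ℕ.* q ℕ.* q             ≤⟨ ℕ.*-monoˡ-≤ q 8q≤n ⟩
    n ℕ.* q                   ∎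
    where
    open ℕ.≤-Reasoning
    4[2qq]≡8qq : ∀ q → 4 ℕ.* (2 ℕ.* (q ℕ.* q)) ≡ 8 ℕ.* q ℕ.* q
    4[2qq]≡8qq = solve-∀

  mutual
    isEven : ℕ → Bool
    isEven zero    = true
    isEven (suc k) = isOdd k

    isOdd : ℕ → Bool
    isOdd zero    = false
    isOdd (suc k) = isEven k

  isOdd≡not-isEven : ∀ k → isOdd k ≡ not (isEven k)
  isOdd≡not-isEven zero    = refl
  isOdd≡not-isEven (suc k) = trans (sym (not-involutive (isEven k))) (cong not (sym (isOdd≡not-isEven k)))

  module _ {A : Set} where

    sum-map-+ : ∀ (f g : A → ℕ) xs → sum (map (λ a → f a ℕ.+ g a) xs) ≡ sum (map f xs) ℕ.+ sum (map g xs)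
    sum-map-+ f g []       = refl
    sum-map-+ f g (x ∷ xs) = trans (cong (f x ℕ.+ g x ℕ.+_) (sum-map-+ f g xs)) (+-interchange (f x) (g x) _ _)

    sum-map-const : ∀ c (xs : List A) → sum (map (λ _ → c) xs) ≡ length xs ℕ.* c
    sum-map-const c []       = refl
    sum-map-const c (x ∷ xs) = cong (c ℕ.+_) (sum-map-const c xs)

    sum-map-*ˡ : ∀ c (f : A → ℕ) xs → sum (map (λ a → c ℕ.* f a) xs) ≡ c ℕ.* sum (map f xs)
    sum-map-*ˡ c f []       = sym (ℕ.*-zeroʳ c)
    sum-map-*ˡ c f (x ∷ xs) = trans (cong (c ℕ.* f x ℕ.+_) (sum-map-*ˡ c f xs)) (sym (ℕ.*-distribˡ-+ c (f x) _))

    sum-map-concatMap : ∀ {B : Set} (g : B → ℕ) (h : A → List B) xs →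
                        sum (map g (concatMap h xs)) ≡ sum (map (λ a → sum (map g (h a))) xs)
    sum-map-concatMap g h []       = refl
    sum-map-concatMap g h (x ∷ xs) = trans (cong sum (map-++ g (h x) (concatMap h xs)))
      (trans (sum-++ (map g (h x)) _) (cong (sum (map g (h x)) ℕ.+_) (sum-map-concatMap g h xs)))

    length-concatMap : ∀ {B : Set} (h : A → List B) xs → length (concatMap h xs) ≡ sum (map (λ a → length (h a)) xs)
    length-concatMap h []       = refl
    length-concatMap h (x ∷ xs) = trans (length-++ (h x)) (cong (length (h x) ℕ.+_) (length-concatMap h xs))

    length-filter-mono : ∀ {P Q : A → Set} (P? : ∀ a → Dec (P a)) (Q? : ∀ a → Dec (Q a)) →
                         (∀ {a} → P a → Q a) → ∀ xs → length (filter P? xs) ℕ.≤ length (filter Q? xs)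
    length-filter-mono P? Q? P⇒Q []       = z≤n
    length-filter-mono P? Q? P⇒Q (x ∷ xs) with P? x | Q? x
    ... | yes _  | yes _  = s≤s (length-filter-mono P? Q? P⇒Q xs)
    ... | yes px | no ¬qx = contradiction (P⇒Q px) ¬qx
    ... | no _   | yes _  = ℕ.m≤n⇒m≤1+n (length-filter-mono P? Q? P⇒Q xs)
    ... | no _   | no _   = length-filter-mono P? Q? P⇒Q xs

    length-filter-∷ : ∀ (p : A → Bool) x xs → length (filter (λ a → T? (p a)) xs) ℕ.≤ length (filter (λ a → T? (p a)) (x ∷ xs))
    length-filter-∷ p x xs with p x
    ... | true  = ℕ.n≤1+n _
    ... | false = ℕ.≤-refl

    All-filter-tabulate : ∀ {P : A → Set} (p : A → Bool) {m} (g : Fin m → A) → (∀ j → T (p (g j)) → P (g j)) →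
                          All P (filter (λ a → T? (p a)) (tabulate g))
    All-filter-tabulate p {zero}  g h = []
    All-filter-tabulate p {suc m} g h with p (g zero) in eq
    ... | true  = h zero (Equivalence.from T-≡ eq) ∷ All-filter-tabulate p (λ j → g (suc j)) (λ j → h (suc j))
    ... | false = All-filter-tabulate p (λ j → g (suc j)) (λ j → h (suc j))

    ⌊/2⌋≤length-filter-tabulate : ∀ (p : A → Bool) {m} (g : Fin m → A) b → (∀ j → isEven (toℕ j) ≡ b → T (p (g j))) →
                                  ⌊ m /2⌋ ℕ.≤ length (filter (λ a → T? (p a)) (tabulate g))
    ⌊/2⌋≤length-filter-tabulate p {zero}        g b h = z≤n
    ⌊/2⌋≤length-filter-tabulate p {suc zero}    g b h = z≤n
    ⌊/2⌋≤length-filter-tabulate p {suc (suc m)} g b h = ℕ.≤-trans (s≤s rest) (first-two b h)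
      where
      later = tabulate (λ j → g (suc (suc j)))
      rest = ⌊/2⌋≤length-filter-tabulate p (λ j → g (suc (suc j))) b (λ j → h (suc (suc j)))
      first-two : ∀ b → (∀ j → isEven (toℕ j) ≡ b → T (p (g j))) →
                  suc (length (filter (λ a → T? (p a)) later)) ℕ.≤ length (filter (λ a → T? (p a)) (g zero ∷ g (suc zero) ∷ later))
      first-two true  h with p (g zero) | h zero refl
      ... | true | _ = s≤s (length-filter-∷ p _ later)
      first-two false h = ℕ.≤-trans second (length-filter-∷ p (g zero) (g (suc zero) ∷ later))
        where
        second : suc (length (filter (λ a → T? (p a)) later)) ℕ.≤ length (filter (λ a → T? (p a)) (g (suc zero) ∷ later))
        second with p (g (suc zero)) | h (suc zero) refl
        ... | true | _ = ℕ.≤-refl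

    module _ (f : A → ℕ) (r : ℕ) where

      markov : ∀ xs → suc r ℕ.* length (filter (λ a → ¬? (f a ℕ.≤? r)) xs) ℕ.≤ sum (map f xs)
      markov []       = ℕ.≤-reflexive (ℕ.*-zeroʳ (suc r))
      markov (x ∷ xs) with f x ℕ.≤ᵇ r in eq
      ... | true  = ℕ.≤-trans (markov xs) (ℕ.m≤n+m _ (f x))
      ... | false = ℕ.≤-trans (ℕ.≤-reflexive (ℕ.*-suc (suc r) _)) (ℕ.+-mono-≤ r<fx (markov xs))
        where
        r<fx : r ℕ.< f x
        r<fx = ℕ.≰⇒> (λ fx≤r → subst T eq (ℕ.≤⇒≤ᵇ fx≤r))

      length-filter-≤?+¬ : ∀ xs → length (filter (λ a → f a ℕ.≤? r) xs) ℕ.+ length (filter (λ a → ¬? (f a ℕ.≤? r)) xs) ≡ length xs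
      length-filter-≤?+¬ []       = refl
      length-filter-≤?+¬ (x ∷ xs) with f x ℕ.≤ᵇ r
      ... | true  = cong suc (length-filter-≤?+¬ xs)
      ... | false = trans (ℕ.+-suc _ _) (cong suc (length-filter-≤?+¬ xs))

      markov-half : ∀ xs → 2 ℕ.* sum (map f xs) ℕ.≤ suc r ℕ.* length xs →
                    length xs ℕ.≤ 2 ℕ.* length (filter (λ a → f a ℕ.≤? r) xs)
      markov-half xs avg = ℕ.+-cancelʳ-≤ (2 ℕ.* bad) L (2 ℕ.* good) (begin
        L ℕ.+ 2 ℕ.* bad              ≤⟨ ℕ.+-monoʳ-≤ L 2bad≤L ⟩
        L ℕ.+ L                      ≡⟨ cong (L ℕ.+_) (ℕ.+-identityʳ L) ⟨
        2 ℕ.* L                      ≡⟨ cong (2 ℕ.*_) (length-filter-≤?+¬ xs) ⟨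
        2 ℕ.* (good ℕ.+ bad)         ≡⟨ ℕ.*-distribˡ-+ 2 good bad ⟩
        2 ℕ.* good ℕ.+ 2 ℕ.* bad     ∎)
        where
        open ℕ.≤-Reasoning
        L = length xs
        good = length (filter (λ a → f a ℕ.≤? r) xs)
        bad = length (filter (λ a → ¬? (f a ℕ.≤? r)) xs)
        2bad≤L : 2 ℕ.* bad ℕ.≤ L
        2bad≤L = ℕ.*-cancelˡ-≤ (suc r) (begin
          suc r ℕ.* (2 ℕ.* bad) ≡⟨ *-left-comm (suc r) 2 bad ⟩
          2 ℕ.* (suc r ℕ.* bad) ≤⟨ ℕ.*-monoʳ-≤ 2 (markov xs) ⟩
          2 ℕ.* sum (map f xs)  ≤⟨ avg ⟩
          suc r ℕ.* L           ∎)

  length-allFin : ∀ n → length (allFin n) ≡ n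
  length-allFin n = length-tabulate (λ i → i)

  -- Rational averages

  fromℕ : ℕ → ℚ
  fromℕ k = mkℚ (+ k) 0 (Coprime.sym (1-coprimeTo k))

  /1≡fromℕ : ∀ k → + k / 1 ≡ fromℕ k
  /1≡fromℕ k = ↥p/↧p≡p (fromℕ k)

  fromℕ-+ : ∀ a b → fromℕ (a ℕ.+ b) ≡ fromℕ a + fromℕ b
  fromℕ-+ a b = sym (trans (cong (_/ 1) (cong₂ ℤ._+_ (ℤ.*-identityʳ (+ a)) (ℤ.*-identityʳ (+ b))))
                           (/1≡fromℕ (a ℕ.+ b)))

  fromℕ-* : ∀ a b → fromℕ (a ℕ.* b) ≡ fromℕ a * fromℕ b
  fromℕ-* a b = sym (trans (cong (_/ 1) (sym (ℤ.pos-* a b))) (/1≡fromℕ (a ℕ.* b)))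

  fromℕ-suc : ∀ k → fromℕ (suc k) ≡ 1ℚ + fromℕ k
  fromℕ-suc = fromℕ-+ 1

  fromℕ-2+ : ∀ k → fromℕ (suc (suc k)) ≡ 1ℚ + (1ℚ + fromℕ k)
  fromℕ-2+ k = trans (fromℕ-suc (suc k)) (cong (_+_ 1ℚ) (fromℕ-suc k))

  fromℕ-mono-≤ : ∀ {a b} → a ℕ.≤ b → fromℕ a ≤ fromℕ b
  fromℕ-mono-≤ {a} {b} a≤b =
    *≤* (subst₂ ℤ._≤_ (sym (ℤ.*-identityʳ (+ a))) (sym (ℤ.*-identityʳ (+ b))) (+≤+ a≤b))

  fromℕ-mono-< : ∀ {a b} → a ℕ.< b → fromℕ a < fromℕ b
  fromℕ-mono-< {a} {b} a<b =
    *<* (subst₂ ℤ._<_ (sym (ℤ.*-identityʳ (+ a))) (sym (ℤ.*-identityʳ (+ b))) (ℤ.+<+ a<b))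

  inv-suc : ∀ k → inv (suc k) ≡ mkℚ (+ 1) k (1-coprimeTo (suc k))
  inv-suc k = ↥p/↧p≡p _

  inv-nonNeg : ∀ k → 0ℚ ≤ inv k
  inv-nonNeg zero    = ≤-refl
  inv-nonNeg (suc k) = subst (0ℚ ≤_) (sym (inv-suc k)) (nonNegative⁻¹ _)

  inv-pos : ∀ k → 0ℚ < inv (suc k)
  inv-pos k = subst (0ℚ <_) (sym (inv-suc k)) (positive⁻¹ _)

  inv-antimono : ∀ {a b} → b ℕ.≤ a → inv (suc a) ≤ inv (suc b)
  inv-antimono {a} {b} b≤a = subst₂ _≤_ (sym (inv-suc a)) (sym (inv-suc b))
    (*≤* (subst₂ ℤ._≤_ (sym (ℤ.*-identityˡ (+ suc b))) (sym (ℤ.*-identityˡ (+ suc a))) (+≤+ (s≤s b≤a))))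

  fromℕ*inv≡1 : ∀ k → fromℕ (suc k) * inv (suc k) ≡ 1ℚ
  fromℕ*inv≡1 k = trans (cong (fromℕ (suc k) *_) (inv-suc k)) (*-inverseʳ (fromℕ (suc k)))

  fromℕ*inv<1 : ∀ {a k} → a ℕ.< suc k → fromℕ a * inv (suc k) < 1ℚ
  fromℕ*inv<1 {a} {k} a<1+k = begin-strict
    fromℕ a * inv (suc k)       <⟨ *-monoˡ-<-pos (inv (suc k)) {{positive (inv-pos k)}} (fromℕ-mono-< a<1+k) ⟩
    fromℕ (suc k) * inv (suc k) ≡⟨ fromℕ*inv≡1 k ⟩
    1ℚ                          ∎
    where open ≤-Reasoning

  *inv-monoˡ-≤ : ∀ k {p q} → p ≤ q → p * inv k ≤ q * inv k
  *inv-monoˡ-≤ k = *-monoʳ-≤-nonNeg (inv k) {{nonNegative (inv-nonNeg k)}}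

  fromℕ*-*inv : ∀ k q → fromℕ (suc k) * q * inv (suc k) ≡ q
  fromℕ*-*inv k q = begin
    fromℕ (suc k) * q * inv (suc k)   ≡⟨ solve 3 (λ a b c → a :* b :* c := b :* (a :* c)) refl (fromℕ (suc k)) q (inv (suc k)) ⟩
    q * (fromℕ (suc k) * inv (suc k)) ≡⟨ cong (q *_) (fromℕ*inv≡1 k) ⟩
    q * 1ℚ                            ≡⟨ *-identityʳ q ⟩
    q                                 ∎
    where open ≡-Reasoning

  ≤-*inv : ∀ k {p s} → fromℕ (suc k) * p ≤ s → p ≤ s * inv (suc k)
  ≤-*inv k {p} h = subst (_≤ _) (fromℕ*-*inv k p) (*inv-monoˡ-≤ (suc k) h)

  *inv-≤ : ∀ k {p s} → s ≤ fromℕ (suc k) * p → s * inv (suc k) ≤ p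
  *inv-≤ k {p} h = subst (_ ≤_) (fromℕ*-*inv k p) (*inv-monoˡ-≤ (suc k) h)

  ½≤ratio : ∀ {a k} → suc k ℕ.≤ 2 ℕ.* a → ½ ≤ fromℕ a * inv (suc k)
  ½≤ratio {a} {k} h = ≤-*inv k (begin
    fromℕ (suc k) * ½         ≤⟨ *-monoʳ-≤-nonNeg ½ (fromℕ-mono-≤ h) ⟩
    fromℕ (2 ℕ.* a) * ½       ≡⟨ cong (_* ½) (fromℕ-* 2 a) ⟩
    fromℕ 2 * fromℕ a * ½     ≡⟨ solve 1 (λ a → con (fromℕ 2) :* a :* con ½ := a) refl (fromℕ a) ⟩
    fromℕ a                   ∎)
    where open ≤-Reasoning

  ∣-∣≤width : ∀ {lo hi p q} → lo ≤ p → p ≤ hi → lo ≤ q → q ≤ hi → ∣ p - q ∣ ≤ hi - lo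
  ∣-∣≤width {lo} {hi} {p} {q} lo≤p p≤hi lo≤q q≤hi with ∣p∣≡p∨∣p∣≡-p (p - q)
  ... | inj₁ eq = subst (_≤ hi - lo) (sym eq) (+-mono-≤ p≤hi (neg-antimono-≤ lo≤q))
  ... | inj₂ eq = subst (_≤ hi - lo) (sym (trans eq (solve 2 (λ p q → :- (p :- q) := q :- p) refl p q)))
                        (+-mono-≤ q≤hi (neg-antimono-≤ lo≤p))

  sumℚ-≥ : ∀ {lo ys} → All (lo ≤_) ys → fromℕ (length ys) * lo ≤ sumℚ ys
  sumℚ-≥ {lo} []                 = ≤-reflexive (*-zeroˡ lo)
  sumℚ-≥ {lo} {y ∷ ys} (p ∷ ps) = begin
    fromℕ (suc (length ys)) * lo  ≡⟨ cong (_* lo) (fromℕ-suc (length ys)) ⟩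
    (1ℚ + fromℕ (length ys)) * lo ≡⟨ solve 2 (λ a b → (con 1ℚ :+ a) :* b := b :+ a :* b) refl (fromℕ (length ys)) lo ⟩
    lo + fromℕ (length ys) * lo   ≤⟨ +-mono-≤ p (sumℚ-≥ ps) ⟩
    y + sumℚ ys                   ∎
    where open ≤-Reasoning

  sumℚ-≤ : ∀ {hi ys} → All (_≤ hi) ys → sumℚ ys ≤ fromℕ (length ys) * hi
  sumℚ-≤ {hi} []                 = ≤-reflexive (sym (*-zeroˡ hi))
  sumℚ-≤ {hi} {y ∷ ys} (p ∷ ps) = begin
    y + sumℚ ys                   ≤⟨ +-mono-≤ p (sumℚ-≤ ps) ⟩
    hi + fromℕ (length ys) * hi   ≡⟨ solve 2 (λ a b → b :+ a :* b := (con 1ℚ :+ a) :* b) refl (fromℕ (length ys)) hi ⟩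
    (1ℚ + fromℕ (length ys)) * hi ≡⟨ cong (_* hi) (fromℕ-suc (length ys)) ⟨
    fromℕ (suc (length ys)) * hi  ∎
    where open ≤-Reasoning

  mean : ℚ → List ℚ → ℚ
  mean y ys = (y + sumℚ ys) * inv (suc (length ys))

  mean-≥ : ∀ {lo y ys} → lo ≤ y → All (lo ≤_) ys → lo ≤ mean y ys
  mean-≥ lo≤y lo≤ys = ≤-*inv _ (sumℚ-≥ (lo≤y ∷ lo≤ys))

  mean-≤ : ∀ {hi y ys} → y ≤ hi → All (_≤ hi) ys → mean y ys ≤ hi
  mean-≤ y≤hi ys≤hi = *inv-≤ _ (sumℚ-≤ (y≤hi ∷ ys≤hi))

  mean-≥-outlier : ∀ {lo y z zs} → lo ≤ y → lo - 1ℚ ≤ z → All (lo ≤_) zs →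
                   lo - inv (suc (suc (length zs))) ≤ mean y (z ∷ zs)
  mean-≥-outlier {lo} {y} {z} {zs} lo≤y lo-1≤z lo≤zs = ≤-*inv _ (begin
    s * (lo - i)               ≡⟨ solve 3 (λ s l i → s :* (l :- i) := s :* l :- s :* i) refl s lo i ⟩
    s * lo - s * i             ≡⟨ cong (λ e → s * lo - e) (fromℕ*inv≡1 (suc (length zs))) ⟩
    s * lo - 1ℚ                ≡⟨ cong (λ e → e * lo - 1ℚ) (fromℕ-2+ (length zs)) ⟩
    (1ℚ + (1ℚ + L)) * lo - 1ℚ  ≡⟨ solve 2 (λ L l → (con 1ℚ :+ (con 1ℚ :+ L)) :* l :- con 1ℚ := l :+ ((l :- con 1ℚ) :+ L :* l)) refl L lo ⟩
    lo + ((lo - 1ℚ) + L * lo)  ≤⟨ +-mono-≤ lo≤y (+-mono-≤ lo-1≤z (sumℚ-≥ lo≤zs)) ⟩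
    y + (z + sumℚ zs)          ∎)
    where
    open ≤-Reasoning
    L = fromℕ (length zs)
    s = fromℕ (suc (suc (length zs)))
    i = inv (suc (suc (length zs)))

  mean-≤-outlier : ∀ {hi y z zs} → y ≤ hi → z ≤ hi + 1ℚ → All (_≤ hi) zs →
                   mean y (z ∷ zs) ≤ hi + inv (suc (suc (length zs)))
  mean-≤-outlier {hi} {y} {z} {zs} y≤hi z≤hi+1 zs≤hi = *inv-≤ _ (begin
    y + (z + sumℚ zs)          ≤⟨ +-mono-≤ y≤hi (+-mono-≤ z≤hi+1 (sumℚ-≤ zs≤hi)) ⟩
    hi + ((hi + 1ℚ) + L * hi)  ≡⟨ solve 2 (λ L h → h :+ ((h :+ con 1ℚ) :+ L :* h) := (con 1ℚ :+ (con 1ℚ :+ L)) :* h :+ con 1ℚ) refl L hi ⟩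
    (1ℚ + (1ℚ + L)) * hi + 1ℚ  ≡⟨ cong (λ e → e * hi + 1ℚ) (fromℕ-2+ (length zs)) ⟨
    s * hi + 1ℚ                ≡⟨ cong (λ e → s * hi + e) (fromℕ*inv≡1 (suc (length zs))) ⟨
    s * hi + s * i             ≡⟨ solve 3 (λ s h i → s :* h :+ s :* i := s :* (h :+ i)) refl s hi i ⟩
    s * (hi + i)               ∎)
    where
    open ≤-Reasoning
    L = fromℕ (length zs)
    s = fromℕ (suc (suc (length zs)))
    i = inv (suc (suc (length zs)))

  -- Hegselmann–Krause dynamics

  module _ {n} (G : Graph n) (ε : ℚ) where

    neighbours : Fin n → List (Fin n)
    neighbours v = filter (λ u → T? (adj G v u)) (allFin n)

    others≡neighbours : ∀ x v → (∀ u → T (adj G v u) → len x v u ≤ ε) → others G ε x v ≡ neighbours v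
    others≡neighbours x v short = filter-≐ (λ u → T? (influenceEdge G ε x v u)) (λ u → T? (adj G v u))
      ((λ e → proj₁ (Equivalence.to T-∧ e)) , (λ a → Equivalence.from T-∧ (a , ≤⇒≤ᵇ (short _ a))))
      (allFin n)

    All-others : ∀ {P : Fin n → Set} x v → (∀ u → T (adj G v u) → P u) → All P (others G ε x v)
    All-others x v h = All.map (λ {u} e → h u (proj₁ (Equivalence.to T-∧ e)))
                               (All.all-filter (λ u → T? (influenceEdge G ε x v u)) (allFin n))

    newOpinion≡mean : ∀ x v → newOpinion G ε x v ≡ mean (x v) (map x (others G ε x v))
    newOpinion≡mean x v = cong (λ k → (x v + sumℚ (map x (others G ε x v))) * inv (suc k))
                               (sym (length-map x (others G ε x v)))

    newOpinion-≥ : ∀ {lo} x v → lo ≤ x v → All (λ u → lo ≤ x u) (others G ε x v) → lo ≤ newOpinion G ε x v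
    newOpinion-≥ x v self rest = subst (_ ≤_) (sym (newOpinion≡mean x v)) (mean-≥ self (All.map⁺ rest))

    newOpinion-≤ : ∀ {hi} x v → x v ≤ hi → All (λ u → x u ≤ hi) (others G ε x v) → newOpinion G ε x v ≤ hi
    newOpinion-≤ x v self rest = subst (_≤ _) (sym (newOpinion≡mean x v)) (mean-≤ self (All.map⁺ rest))

    step-elim : ∀ x v (P : Fin n → ℚ → Set) → P v (newOpinion G ε x v) → (∀ w → P w (x w)) →
                ∀ w → P w (step G ε x v w)
    step-elim x v P new old w with w ≟ v
    ... | yes refl = new
    ... | no _     = old w

    step-≥ : ∀ {lo} x v → (∀ u → lo ≤ x u) → ∀ w → lo ≤ step G ε x v w
    step-≥ x v lo≤x = step-elim x v (λ _ q → _ ≤ q) (newOpinion-≥ x v (lo≤x v) (All-others x v (λ u _ → lo≤x u))) lo≤x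

    step-≤ : ∀ {hi} x v → (∀ u → x u ≤ hi) → ∀ w → step G ε x v w ≤ hi
    step-≤ x v x≤hi = step-elim x v (λ _ q → q ≤ _) (newOpinion-≤ x v (x≤hi v) (All-others x v (λ u _ → x≤hi u))) x≤hi

  allB-∈ : ∀ {A : Set} {p : A → Bool} {a xs} → T (allB p xs) → a ∈ xs → T (p a)
  allB-∈ {xs = _ ∷ _} all (here refl) = proj₁ (Equivalence.to T-∧ all)
  allB-∈ {xs = _ ∷ _} all (there a∈) = allB-∈ (proj₂ (Equivalence.to T-∧ all)) a∈

  T-not-∨ : ∀ {a b} → T a → T (not a ∨ b) → T b
  T-not-∨ {true} _ b = b

  isStable-false : ∀ {n} (G : Graph n) ε δ x u v → T (influenceEdge G ε x u v) → δ < len x u v →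
                   isStable G ε δ x ≡ false
  isStable-false G ε δ x u v edge long = ¬-not λ stable →
    <-irrefl refl (<-≤-trans long (≤ᵇ⇒≤ (T-not-∨ edge
      (allB-∈ (allB-∈ (subst T (sym stable) tt) (∈-allFin u)) (∈-allFin v)))))

  totalCost : ∀ {n t} → (Fin n → ℕ) → Vec (Fin n) t → ℕ
  totalCost cost s = Vec.sum (Vec.map cost s)

  module _ {n} (G : Graph n) (ε δ : ℚ) (cost : Fin n → ℕ) (Good : ℕ → State n → Set)
           (good-step : ∀ {k x} v → Good k x → Good (cost v ℕ.+ k) (step G ε x v))
           (r : ℕ) (good-unstable : ∀ {k x} → k ℕ.≤ r → Good k x → isStable G ε δ x ≡ false) where

    neverStable-of-good : ∀ {t k x} (s : Vec (Fin n) t) → Good k x → totalCost cost s ℕ.+ k ℕ.≤ r →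
                          neverStable G ε δ x s ≡ true
    neverStable-of-good []      good k≤r = cong not (good-unstable k≤r good)
    neverStable-of-good {k = k} (v ∷ s) good ≤r = cong₂ _∧_
      (cong not (good-unstable (ℕ.≤-trans (ℕ.m≤n+m k _) ≤r) good))
      (neverStable-of-good s (good-step v good) (subst (ℕ._≤ r) regroup ≤r))
      where
      regroup : (cost v ℕ.+ totalCost cost s) ℕ.+ k ≡ totalCost cost s ℕ.+ (cost v ℕ.+ k)
      regroup = trans (cong (ℕ._+ k) (ℕ.+-comm (cost v) _)) (ℕ.+-assoc _ (cost v) k)

  partialExp-≥ : ∀ {n} (S : HKS n) ε δ p K → (∀ t → t ℕ.< K → p ≤ tailProb S ε δ t) →
                 fromℕ K * p ≤ partialExp S ε δ K
  partialExp-≥ S ε δ p zero    _    = ≤-reflexive (*-zeroˡ p)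
  partialExp-≥ S ε δ p (suc K) tail = begin
    fromℕ (suc K) * p                      ≡⟨ cong (_* p) (fromℕ-suc K) ⟩
    (1ℚ + fromℕ K) * p                     ≡⟨ solve 2 (λ k p → (con 1ℚ :+ k) :* p := k :* p :+ p) refl (fromℕ K) p ⟩
    fromℕ K * p + p                        ≤⟨ +-mono-≤ (partialExp-≥ S ε δ p K (λ t t<K → tail t (ℕ.m<n⇒m<1+n t<K)))
                                                       (tail K ℕ.≤-refl) ⟩
    partialExp S ε δ K + tailProb S ε δ K  ∎
    where open ≤-Reasoning

  tailProb-≥-½ : ∀ {n} .{{_ : ℕ.NonZero n}} (S : HKS n) ε δ t →
                 n ℕ.^ t ℕ.≤ 2 ℕ.* length (filter (λ s → T? (neverStable (graph S) ε δ (x₀ S) s)) (seqs n t)) →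
                 ½ ≤ tailProb S ε δ t
  tailProb-≥-½ {n} S ε δ t h with n ℕ.^ t | ℕ.m^n>0 n t
  ... | suc k | _ = subst (λ q → ½ ≤ q * inv (suc k)) (sym (/1≡fromℕ (length (filter _ (seqs n t))))) (½≤ratio h)

  -- Uniformly random choice sequences

  length-seqs : ∀ n t → length (seqs n t) ≡ n ℕ.^ t
  length-seqs n zero    = refl
  length-seqs n (suc t) = begin
    length (concatMap (λ v → map (v ∷_) (seqs n t)) (allFin n))   ≡⟨ length-concatMap _ (allFin n) ⟩
    sum (map (λ v → length (map (v ∷_) (seqs n t))) (allFin n))   ≡⟨ cong sum (map-cong (λ v → length-map (v ∷_) (seqs n t)) (allFin n)) ⟩
    sum (map (λ _ → length (seqs n t)) (allFin n))                ≡⟨ sum-map-const _ (allFin n) ⟩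
    length (allFin n) ℕ.* length (seqs n t)                       ≡⟨ cong₂ ℕ._*_ (length-allFin n) (length-seqs n t) ⟩
    n ℕ.* n ℕ.^ t                                                 ∎
    where open ≡-Reasoning

  module _ {n} (cost : Fin n → ℕ) where

    private
      C : ℕ
      C = sum (map cost (allFin n))

      Σcost : ℕ → ℕ
      Σcost t = sum (map (totalCost cost) (seqs n t))

    Σcost-suc : ∀ t → Σcost (suc t) ≡ length (seqs n t) ℕ.* C ℕ.+ n ℕ.* Σcost t
    Σcost-suc t = begin
      sum (map (totalCost cost) (concatMap (λ v → map (v ∷_) S) (allFin n)))   ≡⟨ sum-map-concatMap (totalCost cost) _ (allFin n) ⟩
      sum (map (λ v → sum (map (totalCost cost) (map (v ∷_) S))) (allFin n))   ≡⟨ cong sum (map-cong (λ v → cong sum (sym (map-∘ S))) (allFin n)) ⟩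
      sum (map (λ v → sum (map (λ s → cost v ℕ.+ totalCost cost s) S)) (allFin n))
        ≡⟨ cong sum (map-cong (λ v → trans (sum-map-+ (λ _ → cost v) (totalCost cost) S)
                                           (cong (ℕ._+ Σcost t) (sum-map-const (cost v) S))) (allFin n)) ⟩
      sum (map (λ v → length S ℕ.* cost v ℕ.+ Σcost t) (allFin n))             ≡⟨ sum-map-+ _ _ (allFin n) ⟩
      sum (map (λ v → length S ℕ.* cost v) (allFin n)) ℕ.+ sum (map (λ _ → Σcost t) (allFin n))
        ≡⟨ cong₂ ℕ._+_ (sum-map-*ˡ (length S) cost (allFin n)) (sum-map-const (Σcost t) (allFin n)) ⟩
      length S ℕ.* C ℕ.+ length (allFin n) ℕ.* Σcost t                         ≡⟨ cong (λ e → length S ℕ.* C ℕ.+ e ℕ.* Σcost t) (length-allFin n) ⟩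
      length S ℕ.* C ℕ.+ n ℕ.* Σcost t                                         ∎
      where
      open ≡-Reasoning
      S = seqs n t

    -- Each of the t positions contributes C · n^(t-1).
    Σcost-seqs : ∀ t → n ℕ.* Σcost t ≡ t ℕ.* C ℕ.* n ℕ.^ t
    Σcost-seqs zero    = ℕ.*-zeroʳ n
    Σcost-seqs (suc t) = begin
      n ℕ.* Σcost (suc t)                                ≡⟨ cong (n ℕ.*_) (Σcost-suc t) ⟩
      n ℕ.* (length (seqs n t) ℕ.* C ℕ.+ n ℕ.* Σcost t)  ≡⟨ cong₂ (λ a b → n ℕ.* (a ℕ.* C ℕ.+ b)) (length-seqs n t) (Σcost-seqs t) ⟩
      n ℕ.* (n ℕ.^ t ℕ.* C ℕ.+ t ℕ.* C ℕ.* n ℕ.^ t)      ≡⟨ distrib n (n ℕ.^ t) C t ⟩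
      suc t ℕ.* C ℕ.* (n ℕ.* n ℕ.^ t)                    ∎
      where
      open ≡-Reasoning
      distrib : ∀ n p c t → n ℕ.* (p ℕ.* c ℕ.+ t ℕ.* c ℕ.* p) ≡ suc t ℕ.* c ℕ.* (n ℕ.* p)
      distrib = solve-∀

    half-of-seqs-cheap : ∀ .{{_ : ℕ.NonZero n}} r t → 2 ℕ.* t ℕ.* C ℕ.≤ n ℕ.* suc r →
                         n ℕ.^ t ℕ.≤ 2 ℕ.* length (filter (λ s → totalCost cost s ℕ.≤? r) (seqs n t))
    half-of-seqs-cheap r t budget =
      subst (ℕ._≤ 2 ℕ.* length (filter (λ s → totalCost cost s ℕ.≤? r) (seqs n t))) (length-seqs n t)
            (markov-half (totalCost cost) r (seqs n t) average)
      where
      open ℕ.≤-Reasoning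
      average : 2 ℕ.* Σcost t ℕ.≤ suc r ℕ.* length (seqs n t)
      average = ℕ.*-cancelˡ-≤ n (begin
        n ℕ.* (2 ℕ.* Σcost t)                ≡⟨ *-left-comm n 2 (Σcost t) ⟩
        2 ℕ.* (n ℕ.* Σcost t)                ≡⟨ cong (2 ℕ.*_) (Σcost-seqs t) ⟩
        2 ℕ.* (t ℕ.* C ℕ.* n ℕ.^ t)          ≡⟨ ℕ.*-assoc 2 (t ℕ.* C) _ ⟨
        2 ℕ.* (t ℕ.* C) ℕ.* n ℕ.^ t          ≡⟨ cong (ℕ._* n ℕ.^ t) (ℕ.*-assoc 2 t C) ⟨
        2 ℕ.* t ℕ.* C ℕ.* n ℕ.^ t            ≤⟨ ℕ.*-monoˡ-≤ (n ℕ.^ t) budget ⟩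
        n ℕ.* suc r ℕ.* n ℕ.^ t              ≡⟨ ℕ.*-assoc n (suc r) _ ⟩
        n ℕ.* (suc r ℕ.* n ℕ.^ t)            ≡⟨ cong (λ e → n ℕ.* (suc r ℕ.* e)) (length-seqs n t) ⟨
        n ℕ.* (suc r ℕ.* length (seqs n t))  ∎)

  -- Two cliques joined by a bridge

  sameParity≢ : ℕ → ℕ → Bool
  sameParity≢ zero    zero    = false
  sameParity≢ zero    (suc j) = isOdd j
  sameParity≢ (suc i) zero    = isOdd i
  sameParity≢ (suc i) (suc j) = sameParity≢ i j

  sameParity≢-sym : ∀ i j → sameParity≢ i j ≡ sameParity≢ j i
  sameParity≢-sym zero    zero    = refl
  sameParity≢-sym zero    (suc j) = refl
  sameParity≢-sym (suc i) zero    = refl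
  sameParity≢-sym (suc i) (suc j) = sameParity≢-sym i j

  sameParity≢-irrefl : ∀ i → sameParity≢ i i ≡ false
  sameParity≢-irrefl zero    = refl
  sameParity≢-irrefl (suc i) = sameParity≢-irrefl i

  sameParity≢⇒isEven≡ : ∀ i j → T (sameParity≢ i j) → isEven i ≡ isEven j
  sameParity≢⇒isEven≡ zero    (suc j) h = sym (Equivalence.to T-≡ h)
  sameParity≢⇒isEven≡ (suc i) zero    h = Equivalence.to T-≡ h
  sameParity≢⇒isEven≡ (suc i) (suc j) h = begin
    isOdd i        ≡⟨ isOdd≡not-isEven i ⟩
    not (isEven i) ≡⟨ cong not (sameParity≢⇒isEven≡ i j h) ⟩
    not (isEven j) ≡⟨ isOdd≡not-isEven j ⟨
    isOdd j        ∎
    where open ≡-Reasoning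

  bridge : ℕ → ℕ → Bool
  bridge i j = i ℕ.+ j ℕ.≡ᵇ 1

  bridge-irrefl : ∀ i → bridge i i ≡ false
  bridge-irrefl zero          = refl
  bridge-irrefl (suc zero)    = refl
  bridge-irrefl (suc (suc i)) = refl

  barbell : ∀ n → Graph n
  barbell n = record
    { adj    = λ u v → adjacent (toℕ u) (toℕ v)
    ; sym    = λ u v → cong₂ _∨_ (cong (ℕ._≡ᵇ 1) (ℕ.+-comm (toℕ u) (toℕ v))) (sameParity≢-sym (toℕ u) (toℕ v))
    ; irrefl = λ v → cong₂ _∨_ (bridge-irrefl (toℕ v)) (sameParity≢-irrefl (toℕ v))
    }
    where
    adjacent : ℕ → ℕ → Bool
    adjacent i j = bridge i j ∨ sameParity≢ i j

  polarisedOpinions : ∀ n → State n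
  polarisedOpinions n u = if isEven (toℕ u) then 1ℚ else 0ℚ

  barbellHKS : ∀ n → HKS n
  barbellHKS n = record { graph = barbell n ; x₀ = polarisedOpinions n }

  Near : ℚ → Bool → ℚ → Set
  Near d true  q = 1ℚ - d ≤ q
  Near d false q = q ≤ d

  Near-mono : ∀ {d d' q} b → d ≤ d' → Near d b q → Near d' b q
  Near-mono true  d≤d' near = ≤-trans (+-monoʳ-≤ 1ℚ (neg-antimono-≤ d≤d')) near
  Near-mono false d≤d' near = ≤-trans near d≤d'

  newOpinion-Near : ∀ {n} (G : Graph n) ε x v {d} b → Near d b (x v) → All (λ u → Near d b (x u)) (others G ε x v) →
                    Near d b (newOpinion G ε x v)
  newOpinion-Near G ε x v true  = newOpinion-≥ G ε x v
  newOpinion-Near G ε x v false = newOpinion-≤ G ε x v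

  record Polarised {n} (d : ℚ) (x : State n) : Set where
    field
      nonNeg : ∀ u → 0ℚ ≤ x u
      ≤1     : ∀ u → x u ≤ 1ℚ
      near   : ∀ u → Near d (isEven (toℕ u)) (x u)

    short : ∀ u v → len x u v ≤ 1ℚ
    short u v = ∣-∣≤width (nonNeg u) (≤1 u) (nonNeg v) (≤1 v)

  open Polarised

  polarised-initial : ∀ n → Polarised 0ℚ (polarisedOpinions n)
  polarised-initial n = record
    { nonNeg = λ u → proj₁ (bounds (isEven (toℕ u)))
    ; ≤1     = λ u → proj₁ (proj₂ (bounds (isEven (toℕ u))))
    ; near   = λ u → proj₂ (proj₂ (bounds (isEven (toℕ u))))
    }
    where
    bounds : ∀ b → let q = if b then 1ℚ else 0ℚ in (0ℚ ≤ q) × (q ≤ 1ℚ) × Near 0ℚ b q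
    bounds true  = nonNegative⁻¹ 1ℚ , ≤-refl , ≤-refl
    bounds false = ≤-refl , nonNegative⁻¹ 1ℚ , ≤-refl

  bridgeCost : ∀ {n} → Fin n → ℕ
  bridgeCost zero          = 1
  bridgeCost (suc zero)    = 1
  bridgeCost (suc (suc _)) = 0

  module BarbellDynamics (m : ℕ) where

    N : ℕ
    N = suc (suc m)

    G : Graph N
    G = barbell N

    M : ℕ
    M = suc (suc ⌊ m /2⌋)

    newOpinion≡mean-neighbours : ∀ {d x} → Polarised d x → ∀ v → newOpinion G 1ℚ x v ≡ mean (x v) (map x (neighbours G 1ℚ v))
    newOpinion≡mean-neighbours {x = x} P v = trans (newOpinion≡mean G 1ℚ x v)
      (cong (λ L → mean (x v) (map x L)) (others≡neighbours G 1ℚ x v (λ u _ → short P v u)))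

    polarised-step-slack : ∀ {d d' x} v → d ≤ d' → Polarised d x → Near d' (isEven (toℕ v)) (newOpinion G 1ℚ x v) →
                           Polarised d' (step G 1ℚ x v)
    polarised-step-slack {d} {d'} {x} v d≤d' P new = record
      { nonNeg = step-≥ G 1ℚ x v (nonNeg P)
      ; ≤1     = step-≤ G 1ℚ x v (≤1 P)
      ; near   = step-elim G 1ℚ x v (λ w q → Near d' (isEven (toℕ w)) q) new (λ w → Near-mono _ d≤d' (near P w))
      }

    newOpinion-interior : ∀ {d x} → Polarised d x → ∀ j → Near d (isEven (toℕ j)) (newOpinion G 1ℚ x (suc (suc j)))
    newOpinion-interior {d} {x} P j = newOpinion-Near G 1ℚ x v _ (near P v) (All-others G 1ℚ x v same-side)
      where
      v = suc (suc j)
      same-side : ∀ u → T (adj G v u) → Near d (isEven (toℕ v)) (x u)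
      same-side u a = subst (λ b → Near d b (x u)) (sym (sameParity≢⇒isEven≡ (toℕ v) (toℕ u) a)) (near P u)

    farNeighbours : Fin N → List (Fin N)
    farNeighbours v = filter (λ u → T? (adj G v u)) (tabulate (λ j → suc (suc j)))

    far-Near : ∀ {d x} → Polarised d x → ∀ v → All (λ u → Near d (isEven (toℕ v)) (x u)) (farNeighbours v)
    far-Near {d} {x} P v = All-filter-tabulate (adj G v) (λ j → suc (suc j))
      (λ j a → subst (λ b → Near d b (x (suc (suc j))))
                     (sameParity≢⇒isEven≡ (toℕ (suc (suc j))) (toℕ v) (subst T (Graph.sym G v (suc (suc j))) a))
                     (near P _))

    degree-far₀ : ⌊ m /2⌋ ℕ.≤ length (farNeighbours zero)
    degree-far₀ = ⌊/2⌋≤length-filter-tabulate (adj G zero) (λ j → suc (suc j)) true (λ j e → Equivalence.from T-≡ e)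

    degree-far₁ : ⌊ m /2⌋ ℕ.≤ length (farNeighbours (suc zero))
    degree-far₁ = ⌊/2⌋≤length-filter-tabulate (adj G (suc zero)) (λ j → suc (suc j)) false
      (λ j e → Equivalence.from T-≡ (trans (isOdd≡not-isEven (toℕ j)) (cong not e)))

    inv-far≤inv-M : ∀ (x : State N) v → ⌊ m /2⌋ ℕ.≤ length (farNeighbours v) →
                    inv (suc (suc (length (map x (farNeighbours v))))) ≤ inv M
    inv-far≤inv-M x v deg = inv-antimono (s≤s (ℕ.≤-trans deg (ℕ.≤-reflexive (sym (length-map x (farNeighbours v))))))

    newOpinion-bridge₀ : ∀ {d x} → 0ℚ ≤ d → Polarised d x → 1ℚ - (d + inv M) ≤ newOpinion G 1ℚ x zero
    newOpinion-bridge₀ {d} {x} 0≤d P = begin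
      1ℚ - (d + inv M)                 ≡⟨ solve 2 (λ d i → con 1ℚ :- (d :+ i) := (con 1ℚ :- d) :- i) refl d (inv M) ⟩
      (1ℚ - d) - inv M                 ≤⟨ +-monoʳ-≤ (1ℚ - d) (neg-antimono-≤ (inv-far≤inv-M x zero degree-far₀)) ⟩
      (1ℚ - d) - inv (suc (suc (length (map x (farNeighbours zero)))))
                                       ≤⟨ mean-≥-outlier (near P zero) pulled (All.map⁺ (far-Near P zero)) ⟩
      mean (x zero) (map x (neighbours G 1ℚ zero)) ≡⟨ newOpinion≡mean-neighbours P zero ⟨
      newOpinion G 1ℚ x zero           ∎
      where
      open ≤-Reasoning
      pulled : (1ℚ - d) - 1ℚ ≤ x (suc zero)
      pulled = begin
        (1ℚ - d) - 1ℚ ≡⟨ solve 1 (λ d → (con 1ℚ :- d) :- con 1ℚ := :- d) refl d ⟩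
        - d           ≤⟨ neg-antimono-≤ 0≤d ⟩
        0ℚ            ≤⟨ nonNeg P (suc zero) ⟩
        x (suc zero)  ∎

    newOpinion-bridge₁ : ∀ {d x} → 0ℚ ≤ d → Polarised d x → newOpinion G 1ℚ x (suc zero) ≤ d + inv M
    newOpinion-bridge₁ {d} {x} 0≤d P = begin
      newOpinion G 1ℚ x (suc zero)     ≡⟨ newOpinion≡mean-neighbours P (suc zero) ⟩
      mean (x (suc zero)) (map x (neighbours G 1ℚ (suc zero)))
                                       ≤⟨ mean-≤-outlier (near P (suc zero)) pushed (All.map⁺ (far-Near P (suc zero))) ⟩
      d + inv (suc (suc (length (map x (farNeighbours (suc zero))))))
                                       ≤⟨ +-monoʳ-≤ d (inv-far≤inv-M x (suc zero) degree-far₁) ⟩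
      d + inv M                        ∎
      where
      open ≤-Reasoning
      pushed : x zero ≤ d + 1ℚ
      pushed = ≤-trans (≤1 P zero) (+-monoˡ-≤ 1ℚ 0≤d)

    -- k counts the updates of bridge endpoints so far; each may cost 1/M of slack.
    slack : ℕ → ℚ
    slack k = fromℕ k * inv M

    slack-nonNeg : ∀ k → 0ℚ ≤ slack k
    slack-nonNeg k = subst (_≤ slack k) (*-zeroˡ (inv M)) (*inv-monoˡ-≤ M (fromℕ-mono-≤ z≤n))

    slack-suc : ∀ k → slack (suc k) ≡ slack k + inv M
    slack-suc k = trans (cong (_* inv M) (fromℕ-suc k))
                        (solve 2 (λ k i → (con 1ℚ :+ k) :* i := k :* i :+ i) refl (fromℕ k) (inv M))

    slack≤slack+inv : ∀ k → slack k ≤ slack k + inv M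
    slack≤slack+inv k = subst (_≤ slack k + inv M) (+-identityʳ (slack k)) (+-monoʳ-≤ (slack k) (inv-nonNeg M))

    slack-small : ∀ {k} → 4 ℕ.* k ℕ.< M → slack k + slack k < ½
    slack-small {k} 4k<M = begin-strict
      slack k + slack k                  ≡⟨ solve 2 (λ k i → k :* i :+ k :* i := con ½ :* ((con (fromℕ 4) :* k) :* i)) refl (fromℕ k) (inv M) ⟩
      ½ * ((fromℕ 4 * fromℕ k) * inv M)  ≡⟨ cong (λ e → ½ * (e * inv M)) (fromℕ-* 4 k) ⟨
      ½ * (fromℕ (4 ℕ.* k) * inv M)      <⟨ *-monoʳ-<-pos ½ (fromℕ*inv<1 4k<M) ⟩
      ½ * 1ℚ                             ≡⟨ *-identityʳ ½ ⟩
      ½                                  ∎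
      where open ≤-Reasoning

    M>4r : ∀ r → 8 ℕ.* suc r ℕ.≤ N → 4 ℕ.* r ℕ.< M
    M>4r r 8q≤N = ℕ.*-cancelˡ-< 2 (4 ℕ.* r) M (begin-strict
      2 ℕ.* (4 ℕ.* r)              ≡⟨ ℕ.*-assoc 2 4 r ⟨
      8 ℕ.* r                      <⟨ ℕ.m<m+n (8 ℕ.* r) (s≤s z≤n) ⟩
      8 ℕ.* r ℕ.+ 8                ≡⟨ 8r+8≡8[1+r] r ⟩
      8 ℕ.* suc r                  ≤⟨ 8q≤N ⟩
      2 ℕ.+ m                      ≤⟨ ℕ.+-monoʳ-≤ 2 (n≤1+⌊n/2⌋+⌊n/2⌋ m) ⟩
      2 ℕ.+ suc (k ℕ.+ k)          ≤⟨ ℕ.n≤1+n _ ⟩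
      suc (2 ℕ.+ suc (k ℕ.+ k))    ≡⟨ 4+2k≡2[2+k] k ⟩
      2 ℕ.* M                      ∎)
      where
      open ℕ.≤-Reasoning
      k = ⌊ m /2⌋
      8r+8≡8[1+r] : ∀ r → 8 ℕ.* r ℕ.+ 8 ≡ 8 ℕ.* suc r
      8r+8≡8[1+r] = solve-∀
      4+2k≡2[2+k] : ∀ k → suc (2 ℕ.+ suc (k ℕ.+ k)) ≡ 2 ℕ.* suc (suc k)
      4+2k≡2[2+k] = solve-∀

    polarised-step : ∀ {k x} v → Polarised (slack k) x → Polarised (slack (bridgeCost v ℕ.+ k)) (step G 1ℚ x v)
    polarised-step {k} zero P = subst (λ d → Polarised d _) (sym (slack-suc k))
      (polarised-step-slack zero (slack≤slack+inv k) P (newOpinion-bridge₀ (slack-nonNeg k) P))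
    polarised-step {k} (suc zero) P = subst (λ d → Polarised d _) (sym (slack-suc k))
      (polarised-step-slack (suc zero) (slack≤slack+inv k) P (newOpinion-bridge₁ (slack-nonNeg k) P))
    polarised-step (suc (suc j)) P = polarised-step-slack (suc (suc j)) ≤-refl P (newOpinion-interior P j)

    polarised-unstable : ∀ {d x} → Polarised d x → d + d < ½ → isStable G 1ℚ ½ x ≡ false
    polarised-unstable {d} {x} P 2d<½ = isStable-false G 1ℚ ½ x zero (suc zero) (≤⇒≤ᵇ (short P zero (suc zero))) long
      where
      open ≤-Reasoning
      gap : ½ < x zero - x (suc zero)
      gap = begin-strict
        ½                      ≡⟨ refl ⟩
        1ℚ - ½                 <⟨ +-monoʳ-< 1ℚ (neg-antimono-< 2d<½) ⟩
        1ℚ - (d + d)           ≡⟨ solve 1 (λ d → con 1ℚ :- (d :+ d) := (con 1ℚ :- d) :- d) refl d ⟩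
        (1ℚ - d) - d           ≤⟨ +-mono-≤ (near P zero) (neg-antimono-≤ (near P (suc zero))) ⟩
        x zero - x (suc zero)  ∎
      long : ½ < len x zero (suc zero)
      long = subst (½ <_) (sym (0≤p⇒∣p∣≡p (≤-trans (nonNegative⁻¹ ½) (<⇒≤ gap)))) gap

    neverStable-cheap : ∀ r → 4 ℕ.* r ℕ.< M → ∀ {t} (s : Vec (Fin N) t) → totalCost bridgeCost s ℕ.≤ r →
                        T (neverStable G 1ℚ ½ (polarisedOpinions N) s)
    neverStable-cheap r 4r<M s cheap = Equivalence.from T-≡
      (neverStable-of-good G 1ℚ ½ bridgeCost (λ k x → Polarised (slack k) x) polarised-step r unstable
                           s initial (ℕ.≤-trans (ℕ.≤-reflexive (ℕ.+-identityʳ _)) cheap))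
      where
      unstable : ∀ {k x} → k ℕ.≤ r → Polarised (slack k) x → isStable G 1ℚ ½ x ≡ false
      unstable k≤r P = polarised-unstable P (slack-small (ℕ.≤-<-trans (ℕ.*-monoʳ-≤ 4 k≤r) 4r<M))
      initial : Polarised (slack 0) (polarisedOpinions N)
      initial = subst (λ d → Polarised d (polarisedOpinions N)) (sym (*-zeroˡ (inv M))) (polarised-initial N)

    Σ-bridgeCost : sum (map (bridgeCost {N}) (allFin N)) ≡ 2
    Σ-bridgeCost = cong (2 ℕ.+_) (begin
      sum (map bridgeCost (tabulate (λ (j : Fin m) → suc (suc j))))
        ≡⟨ cong sum (trans (map-tabulate (λ j → suc (suc j)) (bridgeCost {N})) (sym (map-tabulate (λ j → j) (λ _ → 0)))) ⟩
      sum (map (λ _ → 0) (allFin m))   ≡⟨ sum-map-const 0 (allFin m) ⟩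
      length (allFin m) ℕ.* 0          ≡⟨ ℕ.*-zeroʳ (length (allFin m)) ⟩
      0                                ∎)
      where open ≡-Reasoning

    tailProb-≥-½-barbell : ∀ r t → 4 ℕ.* r ℕ.< M → 4 ℕ.* t ℕ.≤ N ℕ.* suc r → ½ ≤ tailProb (barbellHKS N) 1ℚ ½ t
    tailProb-≥-½-barbell r t 4r<M 4t≤Nq = tailProb-≥-½ (barbellHKS N) 1ℚ ½ t (ℕ.≤-trans
      (half-of-seqs-cheap bridgeCost r t budget)
      (ℕ.*-monoʳ-≤ 2 (length-filter-mono (λ s → totalCost bridgeCost s ℕ.≤? r)
                                         (λ s → T? (neverStable G 1ℚ ½ (polarisedOpinions N) s))
                                         (λ {s} → neverStable-cheap r 4r<M s) (seqs N t))))
      where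
      budget : 2 ℕ.* t ℕ.* sum (map (bridgeCost {N}) (allFin N)) ℕ.≤ N ℕ.* suc r
      budget = subst (λ C → 2 ℕ.* t ℕ.* C ℕ.≤ N ℕ.* suc r) (sym Σ-bridgeCost)
                     (ℕ.≤-trans (ℕ.≤-reflexive (2t2≡4t t)) 4t≤Nq)
        where
        2t2≡4t : ∀ t → 2 ℕ.* t ℕ.* 2 ≡ 4 ℕ.* t
        2t2≡4t = solve-∀

    partialExp-barbell : ∀ r → 8 ℕ.* suc r ℕ.≤ N →
                         fromℕ (suc r ℕ.* suc r) ≤ partialExp (barbellHKS N) 1ℚ ½ (2 ℕ.* (suc r ℕ.* suc r))
    partialExp-barbell r 8q≤N = begin
      fromℕ (q ℕ.* q)                ≡⟨ solve 1 (λ a → a := con (fromℕ 2) :* a :* con ½) refl (fromℕ (q ℕ.* q)) ⟩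
      fromℕ 2 * fromℕ (q ℕ.* q) * ½  ≡⟨ cong (_* ½) (fromℕ-* 2 (q ℕ.* q)) ⟨
      fromℕ (2 ℕ.* (q ℕ.* q)) * ½    ≤⟨ partialExp-≥ (barbellHKS N) 1ℚ ½ ½ (2 ℕ.* (q ℕ.* q))
                                          (λ t t<K → tailProb-≥-½-barbell r t (M>4r r 8q≤N) (4t≤nq {q = q} 8q≤N t<K)) ⟩
      partialExp (barbellHKS N) 1ℚ ½ (2 ℕ.* (q ℕ.* q)) ∎
      where
      open ≤-Reasoning
      q = suc r

  ½<1 : ½ < 1ℚ
  ½<1 = *<* (ℤ.+<+ (s≤s (s≤s z≤n)))

  barbell-quadratic : ∀ n → 8 ℕ.≤ n → Σ ℕ λ K → + 1 / 256 * (+ (n ℕ.* n) / 1) ≤ partialExp (barbellHKS n) 1ℚ ½ K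
  barbell-quadratic n@(suc (suc m)) 8≤n@(s≤s (s≤s _)) with 8q≤n≤16q n 8≤n
  ... | r , 8q≤n , n≤16q = 2 ℕ.* (q ℕ.* q) , (begin
    c * (+ (n ℕ.* n) / 1)              ≡⟨ cong (c *_) (/1≡fromℕ (n ℕ.* n)) ⟩
    c * fromℕ (n ℕ.* n)                ≤⟨ *-monoˡ-≤-nonNeg c (fromℕ-mono-≤ n²≤256q²) ⟩
    c * fromℕ (256 ℕ.* (q ℕ.* q))      ≡⟨ cong (c *_) (fromℕ-* 256 (q ℕ.* q)) ⟩
    c * (fromℕ 256 * fromℕ (q ℕ.* q))  ≡⟨ solve 1 (λ a → con c :* (con (fromℕ 256) :* a) := a) refl (fromℕ (q ℕ.* q)) ⟩
    fromℕ (q ℕ.* q)                    ≤⟨ BarbellDynamics.partialExp-barbell m r 8q≤n ⟩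
    partialExp (barbellHKS n) 1ℚ ½ (2 ℕ.* (q ℕ.* q)) ∎)
    where
    open ≤-Reasoning
    c = + 1 / 256
    q = suc r
    n²≤256q² : n ℕ.* n ℕ.≤ 256 ℕ.* (q ℕ.* q)
    n²≤256q² = ℕ.≤-trans (ℕ.*-mono-≤ n≤16q n≤16q) (ℕ.≤-reflexive (16q16q≡256qq q))
      where
      16q16q≡256qq : ∀ q → 16 ℕ.* q ℕ.* (16 ℕ.* q) ≡ 256 ℕ.* (q ℕ.* q)
      16q16q≡256qq = solve-∀

open SlowStabilisation using (barbellHKS; barbell-quadratic; ½<1)
open import Defs
open import Data.Nat using (ℕ; _≤_)
open import Data.Integer using (+_)
open import Data.Rational using (ℚ; _<_; _*_; _/_; 1ℚ; ½) renaming (_≤_ to _≤ℚ_)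
open import Data.Rational.Properties using (positive⁻¹)
open import Data.Product using (Σ; _×_; _,_)

theorem5 : Σ ℚ λ ε → Σ ℚ λ δ → (Data.Rational.0ℚ < δ) × (δ < ε) ×
    Σ ((n : ℕ) → 2 ≤ n → HKS n) λ family →
      Σ ℚ λ c → (Data.Rational.0ℚ < c) × Σ ℕ λ n₀ →
        (n : ℕ) → (h : 2 ≤ n) → n₀ ≤ n →
          Σ ℕ λ K → c * ((+ (n Data.Nat.* n)) / 1) ≤ℚ partialExp (family n h) ε δ K
theorem5 = 1ℚ , ½ , positive⁻¹ ½ , ½<1 , (λ n _ → barbellHKS n) , + 1 / 256 , positive⁻¹ (+ 1 / 256) , 8 ,
  λ n _ 8≤n → barbell-quadratic n 8≤n
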